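{- (Chain Rule) Let $X$, $Y$, $Z$ be convergence spaces, let $a\in X$, let $f:Y\to Z$ be a function, and let $g:X\to Y$ be a function continuous at $a$. If $L_f\in\mathcal{D}(Y,Z)$ is a differential of $f$ at $g(a)$ and $L_g\in\mathcal{D}(X,Y)$ is a differential of $g$ at $a$, then $L_f\circ L_g$ is a differential of $f\circ g$ at $a$.
   Context: A filter on a set is a nonempty collection of nonempty subsets closed under supersets and finite intersections. A convergence structure on a set $X$ is a relation $\mathcal{F}\to p$ between filters on $X$ and points of $X$ such that for each $p$ the filters converging to $p$ form a filter on the set of filters on $X$ that contains the point filter $[p]=\{A: p\in A\}$; a convergence space is a set with a convergence structure. A function is continuous at $a$ if it maps filters converging to $a$ to (filters generating) filters converging to the image of $a$. $C(X,Y)$ is the set of continuous maps $X\to Y$ with the continuous convergence structure: $\mathcal{F}\to h$ iff for each $x\in X$ and each filter $\mathcal{A}\to x$, the filter generated by $\{F\cdot A: F\in\mathcal{F},A\in\mathcal{A}\}$, where $F\cdot A=\{k(y):k\in F,y\in A\}$, converges to $h(x)$. For all convergence spaces $X,Y$ a subspace $\mathcal{D}(X,Y)$ of $C(X,Y)$ (with induced convergence) is chosen as the space of admissible differentials, with the standing requirement that these choices are closed under composition: $L\circ M\in\mathcal{D}(X,Z)$ whenever $M\in\mathcal{D}(X,Y)$, $L\in\mathcal{D}(Y,Z)$. Differential: for $L\in\mathcal{D}(X,Y)$, $f:X\to Y$, $a\in X$, $L$ is a differential of $f$ at $a$ iff for every filter $\mathcal{A}\to a$ in $X$ there is a filter $\mathcal{L}\to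 L$ in $\mathcal{D}(X,Y)$ such that for every $K\in\mathcal{L}$ there is $A\in\mathcal{A}$ with $f(x)\in K\cdot\{x\}$ for every $x\in A$. -}

module Defs where

open import Level using (Level; _⊔_; suc; Lift; lift)
open import Data.Product using (Σ; _×_; _,_; proj₁; proj₂)
open import Data.Unit.Polymorphic using (⊤)
open import Relation.Binary.PropositionalEquality using (_≡_; refl)
open import Function using (_∘_)

private
  variable
    a ℓ : Level

Subset : Set a → Set (suc a)
Subset {a} A = A → Set a

_⊆_ : {A : Set a} → Subset A → Subset A → Set a
S ⊆ T = ∀ x → S x → T x

_∩_ : {A : Set a} → Subset A → Subset A → Subset A
(S ∩ T) x = S x × T x

｛_｝ : {A : Set a} → A → Subset A
｛ x ｝ y = y ≡ x

image : {A B : Set a} → (A → B) → Subset A → Subset B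
image {A = A} f S y = Σ A λ x → S x × f x ≡ y

applyˢ : {I A B : Set a} → (I → A → B) → Subset I → Subset A → Subset B
applyˢ {I = I} {A = A} app F S z = Σ I λ k → Σ A λ y → F k × S y × app k y ≡ z

record Filter {a} (A : Set a) : Set (suc (suc a)) where
  field
    mem          : Subset A → Set (suc a)
    mem-inhabited : Σ (Subset A) mem
    mem-nonempty : ∀ {S} → mem S → Σ A S
    mem-upward   : ∀ {S T} → mem S → S ⊆ T → mem T
    mem-∩        : ∀ {S T} → mem S → mem T → mem (S ∩ T)
open Filter public

_⊑_ : {A : Set a} → Filter A → Filter A → Set (suc a)
𝓕 ⊑ 𝓖 = ∀ {S} → mem 𝓕 S → mem 𝓖 S

pointFilter : {A : Set a} → A → Filter A
pointFilter {a} p = record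
  { mem = λ S → Lift (suc a) (S p)
  ; mem-inhabited = (λ y → y ≡ p) , lift refl
  ; mem-nonempty = λ { (lift s) → p , s }
  ; mem-upward = λ { (lift s) st → lift (st p s) }
  ; mem-∩ = λ { (lift s) (lift t) → lift (s , t) }
  }

_⊓_ : {A : Set a} → Filter A → Filter A → Filter A
_⊓_ {a} 𝓕 𝓖 = record
  { mem = λ S → mem 𝓕 S × mem 𝓖 S
  ; mem-inhabited = (λ _ → ⊤) , mem-upward 𝓕 (proj₂ (mem-inhabited 𝓕)) (λ _ _ → _)
                              , mem-upward 𝓖 (proj₂ (mem-inhabited 𝓖)) (λ _ _ → _)
  ; mem-nonempty = λ p → mem-nonempty 𝓕 (proj₁ p)
  ; mem-upward = λ p st → mem-upward 𝓕 (proj₁ p) st , mem-upward 𝓖 (proj₂ p) st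
  ; mem-∩ = λ p q → mem-∩ 𝓕 (proj₁ p) (proj₁ q) , mem-∩ 𝓖 (proj₂ p) (proj₂ q)
  }

record FilterBase {a} (A : Set a) : Set (suc (suc a)) where
  field
    Index           : Set (suc a)
    set             : Index → Subset A
    index-inhabited : Index
    set-nonempty    : ∀ i → Σ A (set i)
    directed        : ∀ i j → Σ Index λ k → set k ⊆ (set i ∩ set j)
open FilterBase public

generated : {A : Set a} → FilterBase A → Filter A
generated 𝓑 = record
  { mem = λ S → Σ (Index 𝓑) λ i → set 𝓑 i ⊆ S
  ; mem-inhabited = set 𝓑 (index-inhabited 𝓑) , index-inhabited 𝓑 , (λ x p → p)
  ; mem-nonempty = λ { (i , sub) → proj₁ (set-nonempty 𝓑 i) , sub _ (proj₂ (set-nonempty 𝓑 i)) }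
  ; mem-upward = λ { (i , sub) st → i , λ x p → st x (sub x p) }
  ; mem-∩ = λ { (i , s) (j , t) →
      proj₁ (directed 𝓑 i j) ,
      λ x p → s x (proj₁ (proj₂ (directed 𝓑 i j) x p)) , t x (proj₂ (proj₂ (directed 𝓑 i j) x p)) }
  }

imageBase : {A B : Set a} → (A → B) → Filter A → FilterBase B
imageBase {A = A} f 𝓕 = record
  { Index = Σ (Subset A) (mem 𝓕)
  ; set = λ i → image f (proj₁ i)
  ; index-inhabited = mem-inhabited 𝓕
  ; set-nonempty = λ { (S , m) → f (proj₁ (mem-nonempty 𝓕 m)) , proj₁ (mem-nonempty 𝓕 m) , proj₂ (mem-nonempty 𝓕 m) , refl }
  ; directed = λ { (S , m) (T , n) → (S ∩ T , mem-∩ 𝓕 m n) ,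
      λ { y (x , (s , t) , eq) → (x , s , eq) , (x , t , eq) } }
  }

mapFilter : {A B : Set a} → (A → B) → Filter A → Filter B
mapFilter f 𝓕 = generated (imageBase f 𝓕)

evalBase : {I A B : Set a} → (I → A → B) → Filter I → Filter A → FilterBase B
evalBase {I = I} {A = A} app 𝓕 𝓐 = record
  { Index = Σ (Subset I) (mem 𝓕) × Σ (Subset A) (mem 𝓐)
  ; set = λ i → applyˢ app (proj₁ (proj₁ i)) (proj₁ (proj₂ i))
  ; index-inhabited = mem-inhabited 𝓕 , mem-inhabited 𝓐
  ; set-nonempty = λ { ((F , m) , (S , n)) →
      app (proj₁ (mem-nonempty 𝓕 m)) (proj₁ (mem-nonempty 𝓐 n)) ,
      proj₁ (mem-nonempty 𝓕 m) , proj₁ (mem-nonempty 𝓐 n) ,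
      proj₂ (mem-nonempty 𝓕 m) , proj₂ (mem-nonempty 𝓐 n) , refl }
  ; directed = λ { ((F , m) , (S , n)) ((F' , m') , (S' , n')) →
      ((F ∩ F' , mem-∩ 𝓕 m m') , (S ∩ S' , mem-∩ 𝓐 n n')) ,
      λ { z (k , y , (fk , fk') , (sy , sy') , eq) →
            (k , y , fk , sy , eq) , (k , y , fk' , sy' , eq) } }
  }

record ConvergenceSpace (a ℓ : Level) : Set (suc (suc a) ⊔ suc ℓ) where
  field
    Carrier : Set a
    _⟶_    : Filter Carrier → Carrier → Set ℓ
    -- for each p, the filters converging to p form a filter in the
    -- lattice of filters containing [p]
    point-conv : ∀ p → pointFilter p ⟶ p
    finer-conv : ∀ {𝓕 𝓖 p} → 𝓕 ⟶ p → 𝓕 ⊑ 𝓖 → 𝓖 ⟶ p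
    meet-conv  : ∀ {𝓕 𝓖 p} → 𝓕 ⟶ p → 𝓖 ⟶ p → (𝓕 ⊓ 𝓖) ⟶ p
open ConvergenceSpace public

module _ (X Y : ConvergenceSpace a ℓ) where

  ContinuousAt : (Carrier X → Carrier Y) → Carrier X → Set (suc (suc a) ⊔ ℓ)
  ContinuousAt g x₀ = (𝓐 : Filter (Carrier X)) → _⟶_ X 𝓐 x₀ → _⟶_ Y (mapFilter g 𝓐) (g x₀)

  Continuous : (Carrier X → Carrier Y) → Set (suc (suc a) ⊔ ℓ)
  Continuous g = ∀ x → ContinuousAt g x

  -- continuous convergence (on the set of all maps X → Y; C(X,Y) carries
  -- its restriction)
  ContConv : Filter (Carrier X → Carrier Y) → (Carrier X → Carrier Y) → Set (suc (suc a) ⊔ ℓ)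
  ContConv 𝓕 h = (x : Carrier X) (𝓐 : Filter (Carrier X)) → _⟶_ X 𝓐 x →
                 _⟶_ Y (generated (evalBase (λ k y → k y) 𝓕 𝓐)) (h x)

record AdmissibleDifferentials (a ℓ : Level) : Set (suc (suc a) ⊔ suc ℓ) where
  field
    IsD   : (X Y : ConvergenceSpace a ℓ) → (Carrier X → Carrier Y) → Set a
    IsD⇒continuous : ∀ X Y L → IsD X Y L → Continuous X Y L
    IsD-∘ : ∀ X Y Z {M L} → IsD X Y M → IsD Y Z L → IsD X Z (L ∘ M)
open AdmissibleDifferentials public

module _ (𝔇 : AdmissibleDifferentials a ℓ) where

  𝒟 : (X Y : ConvergenceSpace a ℓ) → Set a
  𝒟 X Y = Σ (Carrier X → Carrier Y) (IsD 𝔇 X Y)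

  -- convergence of D(X,Y): induced (as a subspace) from continuous
  -- convergence, via the inclusion proj₁
  DConv : (X Y : ConvergenceSpace a ℓ) → Filter (𝒟 X Y) → 𝒟 X Y → Set (suc (suc a) ⊔ ℓ)
  DConv X Y 𝓛 L = ContConv X Y (mapFilter proj₁ 𝓛) (proj₁ L)

  ∘ᴰ : (X Y Z : ConvergenceSpace a ℓ) → 𝒟 Y Z → 𝒟 X Y → 𝒟 X Z
  ∘ᴰ X Y Z (L , l) (M , m) = L ∘ M , IsD-∘ 𝔇 X Y Z m l

  _·ᴰ_ : {X Y : ConvergenceSpace a ℓ} → Subset (𝒟 X Y) → Subset (Carrier X) → Subset (Carrier Y)
  K ·ᴰ A = applyˢ proj₁ K A

  IsDifferential : (X Y : ConvergenceSpace a ℓ) → 𝒟 X Y → (Carrier X → Carrier Y) → Carrier X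
                   → Set (suc (suc a) ⊔ ℓ)
  IsDifferential X Y L f x₀ =
    (𝓐 : Filter (Carrier X)) → _⟶_ X 𝓐 x₀ →
    Σ (Filter (𝒟 X Y)) λ 𝓛 → DConv X Y 𝓛 L ×
      ((K : Subset (𝒟 X Y)) → mem 𝓛 K →
        Σ (Subset (Carrier X)) λ A → mem 𝓐 A ×
          ((x : Carrier X) → A x → (_·ᴰ_ {X} {Y} K ｛ x ｝) (f x)))

-- Given 𝓐 → a, the differential of g yields 𝓛g → Lg, and since g(𝓐) → g(a) the differential
-- of f yields 𝓛f → Lf. The filter 𝓛f ∘ 𝓛g generated by the composites Kf ∘ Kg converges to
-- Lf ∘ Lg, because evaluating it on 𝓒 is finer than evaluating 𝓛f on 𝓛g(𝓒). If
-- f(y) ∈ Kf · {y} on B and g(x) ∈ Kg · {x} on A, then f(g(x)) ∈ (Kf ∘ Kg) · {x} on g⁻¹(B) ∩ A.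
module Submission where

open import Defs
open import Level using (Level)
open import Function using (_∘_)
open import Data.Product using (Σ; _×_; _,_; proj₁)
open import Relation.Binary.PropositionalEquality using (refl)

private
  variable
    a ℓ : Level

⊆-refl : {A : Set a} {S : Subset A} → S ⊆ S
⊆-refl _ Sx = Sx

｛｝⊆ : {A : Set a} {S : Subset A} {x : A} → S x → ｛ x ｝ ⊆ S
｛｝⊆ Sx _ refl = Sx

mem-mapFilter⇒mem-preimage : {A B : Set a} {f : A → B} {𝓐 : Filter A} {S : Subset B} →
                             mem (mapFilter f 𝓐) S → mem 𝓐 (S ∘ f)
mem-mapFilter⇒mem-preimage {f = f} {𝓐} ((T , T∈𝓐) , f[T]⊆S) =
  mem-upward 𝓐 T∈𝓐 λ x Tx → f[T]⊆S (f x) (x , Tx , refl)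

module _ {A B : Set a} {P : (A → B) → Set a} where

  infixl 30 _·_ _⟨$⟩_

  _·_ : Subset (Σ (A → B) P) → Subset A → Subset B
  K · S = applyˢ proj₁ K S

  ·-mono : {K K′ : Subset (Σ (A → B) P)} {S S′ : Subset A} →
           K ⊆ K′ → S ⊆ S′ → K · S ⊆ K′ · S′
  ·-mono K⊆K′ S⊆S′ z (k , y , Kk , Sy , eq) = k , y , K⊆K′ k Kk , S⊆S′ y Sy , eq

  -- The filter 𝓛(𝓒) of continuous convergence, read on the underlying maps of 𝓛.
  _⟨$⟩_ : Filter (Σ (A → B) P) → Filter A → Filter B
  𝓛 ⟨$⟩ 𝓒 = generated (evalBase (λ k y → k y) (mapFilter proj₁ 𝓛) 𝓒)

  ⟨$⟩-intro : {𝓛 : Filter (Σ (A → B) P)} {𝓒 : Filter A} {K : Subset (Σ (A → B) P)}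
              {C : Subset A} {S : Subset B} →
              mem 𝓛 K → mem 𝓒 C → K · C ⊆ S → mem (𝓛 ⟨$⟩ 𝓒) S
  ⟨$⟩-intro {K = K} {C} K∈𝓛 C∈𝓒 K·C⊆S =
    ((image proj₁ K , (K , K∈𝓛) , ⊆-refl) , (C , C∈𝓒)) ,
    λ { z (_ , y , (k , Kk , refl) , Cy , eq) → K·C⊆S z (k , y , Kk , Cy , eq) }

  ⟨$⟩-elim : {𝓛 : Filter (Σ (A → B) P)} {𝓒 : Filter A} {S : Subset B} →
             mem (𝓛 ⟨$⟩ 𝓒) S →
             Σ (Subset (Σ (A → B) P)) λ K → mem 𝓛 K ×
               Σ (Subset A) λ C → mem 𝓒 C × K · C ⊆ S
  ⟨$⟩-elim (((F , (K , K∈𝓛) , proj₁[K]⊆F) , (C , C∈𝓒)) , F·C⊆S) =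
    K , K∈𝓛 , C , C∈𝓒 ,
    λ z (k , y , Kk , Cy , eq) → F·C⊆S z (proj₁ k , y , proj₁[K]⊆F _ (k , Kk , refl) , Cy , eq)

module Composition (𝔇 : AdmissibleDifferentials a ℓ) (X Y Z : ConvergenceSpace a ℓ) where

  infixr 35 _⊚ˢ_ _⊚_

  _⊚ˢ_ : Subset (𝒟 𝔇 Y Z) → Subset (𝒟 𝔇 X Y) → Subset (𝒟 𝔇 X Z)
  Kf ⊚ˢ Kg = applyˢ (∘ᴰ 𝔇 X Y Z) Kf Kg

  _⊚_ : Filter (𝒟 𝔇 Y Z) → Filter (𝒟 𝔇 X Y) → Filter (𝒟 𝔇 X Z)
  𝓛f ⊚ 𝓛g = generated (evalBase (∘ᴰ 𝔇 X Y Z) 𝓛f 𝓛g)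

  composite-apply⊆apply-apply : {Kf : Subset (𝒟 𝔇 Y Z)} {Kg : Subset (𝒟 𝔇 X Y)}
                                {C : Subset (Carrier X)} →
                                (Kf ⊚ˢ Kg) · C ⊆ Kf · (Kg · C)
  composite-apply⊆apply-apply _ (_ , x , (l , m , Kfl , Kgm , refl) , Cx , refl) =
    l , proj₁ m x , Kfl , (m , x , Kgm , Cx , refl) , refl

  apply-apply⊆composite-apply : {Kf : Subset (𝒟 𝔇 Y Z)} {Kg : Subset (𝒟 𝔇 X Y)}
                                {C : Subset (Carrier X)} →
                                Kf · (Kg · C) ⊆ (Kf ⊚ˢ Kg) · C
  apply-apply⊆composite-apply _ (l , _ , Kfl , (m , x , Kgm , Cx , refl) , refl) =
    ∘ᴰ 𝔇 X Y Z l m , x , (l , m , Kfl , Kgm , refl) , Cx , refl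

  ⟨$⟩-⊚ : {𝓛f : Filter (𝒟 𝔇 Y Z)} {𝓛g : Filter (𝒟 𝔇 X Y)} {𝓒 : Filter (Carrier X)} →
          𝓛f ⟨$⟩ (𝓛g ⟨$⟩ 𝓒) ⊑ (𝓛f ⊚ 𝓛g) ⟨$⟩ 𝓒
  ⟨$⟩-⊚ {𝓛f} {𝓛g} {𝓒} S∈
    with Kf , Kf∈ , E , E∈ , Kf·E⊆S ← ⟨$⟩-elim {𝓛 = 𝓛f} {𝓒 = 𝓛g ⟨$⟩ 𝓒} S∈
    with Kg , Kg∈ , C , C∈ , Kg·C⊆E ← ⟨$⟩-elim {𝓛 = 𝓛g} {𝓒 = 𝓒} E∈
    = ⟨$⟩-intro {𝓛 = 𝓛f ⊚ 𝓛g} {𝓒 = 𝓒} (((Kf , Kf∈) , (Kg , Kg∈)) , ⊆-refl) C∈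
        λ z p → Kf·E⊆S z (·-mono ⊆-refl Kg·C⊆E z (composite-apply⊆apply-apply z p))

  DConv-⊚ : {𝓛f : Filter (𝒟 𝔇 Y Z)} {𝓛g : Filter (𝒟 𝔇 X Y)}
            {Lf : 𝒟 𝔇 Y Z} {Lg : 𝒟 𝔇 X Y} →
            DConv 𝔇 Y Z 𝓛f Lf → DConv 𝔇 X Y 𝓛g Lg →
            DConv 𝔇 X Z (𝓛f ⊚ 𝓛g) (∘ᴰ 𝔇 X Y Z Lf Lg)
  DConv-⊚ {𝓛f} {𝓛g} {Lg = Lg} 𝓛f⟶Lf 𝓛g⟶Lg x 𝓒 𝓒⟶x =
    finer-conv Z (𝓛f⟶Lf (proj₁ Lg x) _ (𝓛g⟶Lg x 𝓒 𝓒⟶x)) (⟨$⟩-⊚ {𝓛f} {𝓛g} {𝓒})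

theorem3p6 : {a ℓ : Level} (𝔇 : AdmissibleDifferentials a ℓ)
    (X Y Z : ConvergenceSpace a ℓ) (x₀ : Carrier X)
    (f : Carrier Y → Carrier Z) (g : Carrier X → Carrier Y) →
    ContinuousAt X Y g x₀ →
    (Lf : 𝒟 𝔇 Y Z) (Lg : 𝒟 𝔇 X Y) →
    IsDifferential 𝔇 Y Z Lf f (g x₀) →
    IsDifferential 𝔇 X Y Lg g x₀ →
    IsDifferential 𝔇 X Z (∘ᴰ 𝔇 X Y Z Lf Lg) (f ∘ g) x₀
theorem3p6 𝔇 X Y Z x₀ f g g-cont Lf Lg f-diff g-diff 𝓐 𝓐⟶x₀
  with 𝓛g , 𝓛g⟶Lg , g-approx ← g-diff 𝓐 𝓐⟶x₀
  with 𝓛f , 𝓛f⟶Lf , f-approx ← f-diff (mapFilter g 𝓐) (g-cont 𝓐 𝓐⟶x₀)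
  = 𝓛f ⊚ 𝓛g , DConv-⊚ {𝓛f} {𝓛g} {Lf} {Lg} 𝓛f⟶Lf 𝓛g⟶Lg , approx
  where
  open Composition 𝔇 X Y Z

  approx : (K : Subset (𝒟 𝔇 X Z)) → mem (𝓛f ⊚ 𝓛g) K →
           Σ (Subset (Carrier X)) λ A → mem 𝓐 A × ((x : Carrier X) → A x → (K · ｛ x ｝) (f (g x)))
  approx K (((Kf , Kf∈) , (Kg , Kg∈)) , Kf⊚Kg⊆K)
    with B , B∈g[𝓐] , f∈Kf· ← f-approx Kf Kf∈
    with A , A∈𝓐 , g∈Kg· ← g-approx Kg Kg∈
    = (B ∘ g) ∩ A , mem-∩ 𝓐 (mem-mapFilter⇒mem-preimage {f = g} {𝓐} B∈g[𝓐]) A∈𝓐 ,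
      λ x (Bgx , Ax) →
        ·-mono Kf⊚Kg⊆K ⊆-refl _ (apply-apply⊆composite-apply _
          (·-mono {K = Kf} ⊆-refl (｛｝⊆ (g∈Kg· x Ax)) _ (f∈Kf· (g x) Bgx)))
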